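{- The function $\mathrm{id}\cup\mathtt{sum_g}$ is $\overline b_\alpha$-compatible up to $\mathtt{sub}\cup\mathtt{refl}$, i.e. $(\mathrm{id}\cup\mathtt{sum_g})\circ\overline b_\alpha\subseteq\overline b_\alpha\circ(\mathtt{sub}\cup\mathtt{refl})\circ(\mathrm{id}\cup\mathtt{sum_g})$, and it is $\overline b_\alpha,\overline b_\tau$-compatible up to $\mathrm{id}\cup\mathtt{refl}$, i.e. $(\mathrm{id}\cup\mathtt{sum_g})\circ(\overline b_\alpha\cap\overline b_\tau)\subseteq\overline b_\tau\circ(\mathrm{id}\cup\mathtt{refl})\circ(\mathrm{id}\cup\mathtt{sum_g})$.
   Context: $\pi$-calculus processes: $P ::= !G \mid P|P \mid (\nu a)P \mid G$, $G ::= \mathbf 0 \mid \bar a\langle b\rangle.P \mid a(b).P \mid \tau.P \mid G+G$, up to $\alpha$-conversion; $P\sigma$ is capture-avoiding application of a name substitution. Visible actions $\alpha ::= \bar a\langle b\rangle \mid \bar a(b) \mid ab$ (output, bound output, early input); $\mu::=\alpha\mid\tau$. Early LTS: $a(b).P\xrightarrow{ac}P\{c/b\}$; $\bar a\langle b\rangle.P\xrightarrow{\bar a\langle b\rangle}P$; $\tau.P\xrightarrow\tau P$; if $!G|G\xrightarrow{\mu}P'$ then $!G\xrightarrow{\mu}P'$; if $P\xrightarrow{\bar a\langle b\rangle}P'$, $b\ne a$ then $(\nu b)P\xrightarrow{\bar a(b)}P'$; if $G\xrightarrow\mu P'$ then $G+G'\xrightarrow\mu P'$ and $G'+G\xrightarrow\mu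 P'$; if $P\xrightarrow\mu P'$, $a\notin\mathrm n(\mu)$ then $(\nu a)P\xrightarrow\mu(\nu a)P'$; if $P\xrightarrow\mu P'$, $\mathrm{bn}(\mu)\cap\mathrm{fn}(Q)=\emptyset$ then $P|Q\xrightarrow\mu P'|Q$; if $P\xrightarrow{ab}P'$, $Q\xrightarrow{\bar a\langle b\rangle}Q'$ then $P|Q\xrightarrow\tau P'|Q'$; if $P\xrightarrow{ab}P'$, $Q\xrightarrow{\bar a(b)}Q'$, $b\notin\mathrm{fn}(P)$ then $P|Q\xrightarrow\tau(\nu b)(P'|Q')$; plus symmetric versions. $s_\alpha(\mathcal R)=\{(P,Q)\mid$ for all visible $\alpha$ and $P'$, $P\xrightarrow\alpha P'$ implies $\exists Q'$, $Q\xrightarrow\alpha Q'$, $P'\mathcal RQ'\}$; $s_\tau$ likewise with $\tau$; $b_\alpha(\mathcal R)=\{(P,Q)\mid(P,Q)\in s_\alpha(\mathcal R),(Q,P)\in s_\alpha(\mathcal R^{ -1})\}$, $b_\tau$ likewise; $\overline b_\alpha(\mathcal R)=\mathcal R\cap b_\alpha(\mathcal R)$, $\overline b_\tau(\mathcal R)=\mathcal R\cap b_\tau(\mathcal R)$. $\mathtt{refl}(\mathcal R)=\{(P,P)\}$; $\mathtt{sub}(\mathcal R)=\{(P\sigma,Q\sigma)\mid P\mathcal RQ\}$; $\mathtt{tau}(\mathcal R)=\{(\tau.P,\tau.Q)\mid P\mathcal RQ\}$; $\mathtt{out}(\mathcal R)=\{(\bar a\langle b\rangle.P,\bar a\langle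 b\rangle.Q)\mid P\mathcal RQ\}$; $\mathtt{inp}(\mathcal R)=\{(a(b).P,a(b).Q)\mid P\mathcal RQ\}$; $\mathtt{sum_g}(\mathcal R)=\{(\sum_i G_i,\sum_i G_i')\mid \forall i,\ (G_i,G_i')\in(\mathtt{tau}\cup\mathtt{out}\cup\mathtt{inp}\cup\mathtt{refl})(\mathcal R)\}$ (finite sums). Composition and unions of functions are pointwise. -}

module Defs where

open import Data.Nat using (ℕ; zero; suc)
open import Data.Product using (Σ; ∃; _×_; _,_)
open import Data.Sum using (_⊎_)
open import Data.Unit using (⊤)
open import Data.Empty using (⊥)
open import Relation.Binary.PropositionalEquality using (_≡_)

-- π-calculus syntax, with names as de Bruijn indices (so terms are
-- identified up to α-conversion by construction).  Free names are
-- natural numbers; under a binder, index 0 is the bound name.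

data Proc : Set
data Guard : Set

data Proc where
  bang : Guard → Proc
  _∥_  : Proc → Proc → Proc
  ν    : Proc → Proc
  grd  : Guard → Proc

data Guard where
  nil : Guard
  out : ℕ → ℕ → Proc → Guard
  inp : ℕ → Proc → Guard       -- a(b).P, b = index 0 in P
  tau : Proc → Guard
  _⊕_ : Guard → Guard → Guard

ext : (ℕ → ℕ) → ℕ → ℕ
ext σ zero    = zero
ext σ (suc n) = suc (σ n)

renP : (ℕ → ℕ) → Proc → Proc
renG : (ℕ → ℕ) → Guard → Guard

renP σ (bang G) = bang (renG σ G)
renP σ (P ∥ Q)  = renP σ P ∥ renP σ Q
renP σ (ν P)    = ν (renP (ext σ) P)
renP σ (grd G)  = grd (renG σ G)

renG σ nil       = nil
renG σ (out a b P) = out (σ a) (σ b) (renP σ P)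
renG σ (inp a P) = inp (σ a) (renP (ext σ) P)
renG σ (tau P)   = tau (renP σ P)
renG σ (G ⊕ G')  = renG σ G ⊕ renG σ G'

-- P{c/b} for the body of an input prefix (b = index 0)
inst : ℕ → ℕ → ℕ
inst c zero    = c
inst c (suc n) = n

swap : ℕ → ℕ
swap zero          = suc zero
swap (suc zero)    = zero
swap (suc (suc n)) = suc (suc n)

shift : Proc → Proc
shift = renP suc

-- Actions.  boutA a is the bound output ā(b); its target lives in the
-- extended scope, where index 0 is the extruded name b.

data Act : Set where
  outA  : ℕ → ℕ → Act
  boutA : ℕ → Act
  inA   : ℕ → ℕ → Act
  tauA  : Act

Visible : Act → Set
Visible tauA = ⊥
Visible _    = ⊤

infix 4 _—[_]→_

data _—[_]→_ : Proc → Act → Proc → Set where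
  t-inp   : ∀ {a c P} → grd (inp a P) —[ inA a c ]→ renP (inst c) P
  t-out   : ∀ {a b P} → grd (out a b P) —[ outA a b ]→ P
  t-tau   : ∀ {P} → grd (tau P) —[ tauA ]→ P
  t-bang  : ∀ {G μ P'} → (bang G ∥ grd G) —[ μ ]→ P' → bang G —[ μ ]→ P'
  -- open: (ν b) P —ā(b)→ P' if P —ā⟨b⟩→ P', b ≠ a
  t-open  : ∀ {a P P'} → P —[ outA (suc a) zero ]→ P' → ν P —[ boutA a ]→ P'
  t-sumL  : ∀ {G G' μ P'} → grd G —[ μ ]→ P' → grd (G ⊕ G') —[ μ ]→ P'
  t-sumR  : ∀ {G G' μ P'} → grd G' —[ μ ]→ P' → grd (G ⊕ G') —[ μ ]→ P'
  -- restriction, a ∉ n(μ)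
  t-resOut  : ∀ {a b P P'} → P —[ outA (suc a) (suc b) ]→ P' → ν P —[ outA a b ]→ ν P'
  t-resIn   : ∀ {a b P P'} → P —[ inA (suc a) (suc b) ]→ P' → ν P —[ inA a b ]→ ν P'
  t-resTau  : ∀ {P P'} → P —[ tauA ]→ P' → ν P —[ tauA ]→ ν P'
  t-resBout : ∀ {a P P'} → P —[ boutA (suc a) ]→ P' → ν P —[ boutA a ]→ ν (renP swap P')
  -- parallel composition (bn(μ) ∩ fn(Q) = ∅ is built in by weakening Q)
  t-parLOut  : ∀ {a b P P' Q} → P —[ outA a b ]→ P' → P ∥ Q —[ outA a b ]→ P' ∥ Q
  t-parLIn   : ∀ {a b P P' Q} → P —[ inA a b ]→ P' → P ∥ Q —[ inA a b ]→ P' ∥ Q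
  t-parLTau  : ∀ {P P' Q} → P —[ tauA ]→ P' → P ∥ Q —[ tauA ]→ P' ∥ Q
  t-parLBout : ∀ {a P P' Q} → P —[ boutA a ]→ P' → P ∥ Q —[ boutA a ]→ P' ∥ shift Q
  t-parROut  : ∀ {a b P Q Q'} → Q —[ outA a b ]→ Q' → P ∥ Q —[ outA a b ]→ P ∥ Q'
  t-parRIn   : ∀ {a b P Q Q'} → Q —[ inA a b ]→ Q' → P ∥ Q —[ inA a b ]→ P ∥ Q'
  t-parRTau  : ∀ {P Q Q'} → Q —[ tauA ]→ Q' → P ∥ Q —[ tauA ]→ P ∥ Q'
  t-parRBout : ∀ {a P Q Q'} → Q —[ boutA a ]→ Q' → P ∥ Q —[ boutA a ]→ shift P ∥ Q'
  t-commL : ∀ {a b P P' Q Q'} → P —[ inA a b ]→ P' → Q —[ outA a b ]→ Q' → P ∥ Q —[ tauA ]→ P' ∥ Q'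
  t-commR : ∀ {a b P P' Q Q'} → P —[ outA a b ]→ P' → Q —[ inA a b ]→ Q' → P ∥ Q —[ tauA ]→ P' ∥ Q'
  -- close (b ∉ fn(P) is built in: the receiver is weakened and receives the fresh index 0)
  t-closeL : ∀ {a P P' Q Q'} → shift P —[ inA (suc a) zero ]→ P' → Q —[ boutA a ]→ Q' → P ∥ Q —[ tauA ]→ ν (P' ∥ Q')
  t-closeR : ∀ {a P P' Q Q'} → P —[ boutA a ]→ P' → shift Q —[ inA (suc a) zero ]→ Q' → P ∥ Q —[ tauA ]→ ν (P' ∥ Q')

Rel : Set₁
Rel = Proc → Proc → Set

Fun : Set₁
Fun = Rel → Rel

_⊆_ : Rel → Rel → Set
R ⊆ S = ∀ P Q → R P Q → S P Q

_∩ᵣ_ : Rel → Rel → Rel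
(R ∩ᵣ S) P Q = R P Q × S P Q

_∪ᵣ_ : Rel → Rel → Rel
(R ∪ᵣ S) P Q = R P Q ⊎ S P Q

inv : Rel → Rel
inv R P Q = R Q P

_∘F_ : Fun → Fun → Fun
(f ∘F g) R = f (g R)

_∪F_ : Fun → Fun → Fun
(f ∪F g) R = f R ∪ᵣ g R

_∩F_ : Fun → Fun → Fun
(f ∩F g) R = f R ∩ᵣ g R

idF : Fun
idF R = R

sα : Fun
sα R P Q = ∀ α → Visible α → ∀ P' → P —[ α ]→ P' → ∃ λ Q' → (Q —[ α ]→ Q') × R P' Q'

sτ : Fun
sτ R P Q = ∀ P' → P —[ tauA ]→ P' → ∃ λ Q' → (Q —[ tauA ]→ Q') × R P' Q'

bα : Fun
bα R P Q = sα R P Q × sα (inv R) Q P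

bτ : Fun
bτ R P Q = sτ R P Q × sτ (inv R) Q P

b̄α : Fun
b̄α R = R ∩ᵣ bα R

b̄τ : Fun
b̄τ R = R ∩ᵣ bτ R

refl' : Fun
refl' R P Q = P ≡ Q

sub : Fun
sub R P Q = Σ (ℕ → ℕ) λ σ → ∃ λ P₀ → ∃ λ Q₀ → R P₀ Q₀ × (P ≡ renP σ P₀) × (Q ≡ renP σ Q₀)

tauF : Fun
tauF R P Q = ∃ λ P₀ → ∃ λ Q₀ → R P₀ Q₀ × (P ≡ grd (tau P₀)) × (Q ≡ grd (tau Q₀))

outF : Fun
outF R P Q = ∃ λ a → ∃ λ b → ∃ λ P₀ → ∃ λ Q₀ → R P₀ Q₀ × (P ≡ grd (out a b P₀)) × (Q ≡ grd (out a b Q₀))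

inpF : Fun
inpF R P Q = ∃ λ a → ∃ λ P₀ → ∃ λ Q₀ → R P₀ Q₀ × (P ≡ grd (inp a P₀)) × (Q ≡ grd (inp a Q₀))

-- Finite sums Σᵢ Gᵢ / Σᵢ Gᵢ' (same bracketing on both sides) whose
-- summands pairwise lie in (tau ∪ out ∪ inp ∪ refl)(R).
data SumG (R : Rel) : Guard → Guard → Set where
  summand : ∀ {G G'} → (tauF ∪F (outF ∪F (inpF ∪F refl'))) R (grd G) (grd G') → SumG R G G'
  plus    : ∀ {G₁ G₂ G₁' G₂'} → SumG R G₁ G₁' → SumG R G₂ G₂' → SumG R (G₁ ⊕ G₂) (G₁' ⊕ G₂')

sumg : Fun
sumg R P Q = ∃ λ G → ∃ λ G' → SumG R G G' × (P ≡ grd G) × (Q ≡ grd G')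

{-# OPTIONS --safe #-}
module Submission where

-- A guarded sum moves only through one of its summands, and a summand pair
-- from (tau ∪ out ∪ inp ∪ refl)(R) answers each move with a target pair in R,
-- in an instance P{c/b} R Q{c/b} of R (early input), or in the identity. Hence
-- the sum pairs of sumg(R) are simulated up to sub ∪ refl, and up to id ∪ refl
-- for τ-moves, which only arise from τ-prefixes or identical summands. The
-- converse simulations are the same argument applied to the mirrored sum.

open import Defs
open import Data.Nat using (zero; suc)
open import Data.Product using (∃; _×_; _,_; proj₁)
open import Data.Sum using (inj₁; inj₂)
open import Function using (_∘_)
open import Relation.Binary.Definitions using (Reflexive)
open import Relation.Binary.PropositionalEquality using (_≡_; refl; sym; cong; cong₂)

private
  variable
    R S : Rel
    G G' G₁ G₂ G₁' G₂' : Guard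
    μ : Act

ext-id : ∀ {σ} → (∀ n → σ n ≡ n) → ∀ n → ext σ n ≡ n
ext-id σ-id zero    = refl
ext-id σ-id (suc n) = cong suc (σ-id n)

renP-id : ∀ {σ} → (∀ n → σ n ≡ n) → ∀ P → renP σ P ≡ P
renG-id : ∀ {σ} → (∀ n → σ n ≡ n) → ∀ G → renG σ G ≡ G
renP-id σ-id (bang G) = cong bang (renG-id σ-id G)
renP-id σ-id (P ∥ Q)  = cong₂ _∥_ (renP-id σ-id P) (renP-id σ-id Q)
renP-id σ-id (ν P)    = cong ν (renP-id (ext-id σ-id) P)
renP-id σ-id (grd G)  = cong grd (renG-id σ-id G)
renG-id σ-id nil         = refl
renG-id σ-id (out a b P) rewrite σ-id a | σ-id b = cong (out a b) (renP-id σ-id P)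
renG-id σ-id (inp a P)   rewrite σ-id a = cong (inp a) (renP-id (ext-id σ-id) P)
renG-id σ-id (tau P)     = cong tau (renP-id σ-id P)
renG-id σ-id (G ⊕ G')    = cong₂ _⊕_ (renG-id σ-id G) (renG-id σ-id G')

sub-extensive : R ⊆ sub R
sub-extensive P Q r = (λ n → n) , P , Q , r , sym (renP-id (λ _ → refl) P) , sym (renP-id (λ _ → refl) Q)

sub-inv : sub R ⊆ S → sub (inv R) ⊆ inv S
sub-inv R⊆S P Q (σ , P₀ , Q₀ , r , P≡ , Q≡) = R⊆S Q P (σ , Q₀ , P₀ , r , Q≡ , P≡)

inv-⊆ : R ⊆ S → inv R ⊆ inv S
inv-⊆ R⊆S P Q = R⊆S Q P

b̄α-mono : R ⊆ S → b̄α R ⊆ b̄α S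
b̄α-mono R⊆S P Q (r , fwd , bwd) =
  R⊆S P Q r ,
  (λ α v P' t → let Q' , u , r' = fwd α v P' t in Q' , u , R⊆S P' Q' r') ,
  (λ α v Q' u → let P' , t , r' = bwd α v Q' u in P' , t , R⊆S P' Q' r')

b̄τ-mono : R ⊆ S → b̄τ R ⊆ b̄τ S
b̄τ-mono R⊆S P Q (r , fwd , bwd) =
  R⊆S P Q r ,
  (λ P' t → let Q' , u , r' = fwd P' t in Q' , u , R⊆S P' Q' r') ,
  (λ Q' u → let P' , t , r' = bwd Q' u in P' , t , R⊆S P' Q' r')

Summand : Rel → Rel
Summand = tauF ∪F (outF ∪F (inpF ∪F refl'))

SumG-mono : R ⊆ S → SumG R G G' → SumG S G G'
SumG-mono R⊆S (plus s t) = plus (SumG-mono R⊆S s) (SumG-mono R⊆S t)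
SumG-mono R⊆S (summand (inj₁ (P , Q , r , P≡ , Q≡))) =
  summand (inj₁ (P , Q , R⊆S P Q r , P≡ , Q≡))
SumG-mono R⊆S (summand (inj₂ (inj₁ (a , b , P , Q , r , P≡ , Q≡)))) =
  summand (inj₂ (inj₁ (a , b , P , Q , R⊆S P Q r , P≡ , Q≡)))
SumG-mono R⊆S (summand (inj₂ (inj₂ (inj₁ (a , P , Q , r , P≡ , Q≡))))) =
  summand (inj₂ (inj₂ (inj₁ (a , P , Q , R⊆S P Q r , P≡ , Q≡))))
SumG-mono R⊆S (summand (inj₂ (inj₂ (inj₂ G≡G')))) = summand (inj₂ (inj₂ (inj₂ G≡G')))

SumG-flip : SumG R G G' → SumG (inv R) G' G
SumG-flip (plus s t) = plus (SumG-flip s) (SumG-flip t)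
SumG-flip (summand (inj₁ (P , Q , r , P≡ , Q≡))) = summand (inj₁ (Q , P , r , Q≡ , P≡))
SumG-flip (summand (inj₂ (inj₁ (a , b , P , Q , r , P≡ , Q≡)))) =
  summand (inj₂ (inj₁ (a , b , Q , P , r , Q≡ , P≡)))
SumG-flip (summand (inj₂ (inj₂ (inj₁ (a , P , Q , r , P≡ , Q≡))))) =
  summand (inj₂ (inj₂ (inj₁ (a , Q , P , r , Q≡ , P≡))))
SumG-flip (summand (inj₂ (inj₂ (inj₂ G≡G')))) = summand (inj₂ (inj₂ (inj₂ (sym G≡G'))))

⊕-step : ∀ {P'} →
         (grd G₁ —[ μ ]→ P' → ∃ λ Q' → (grd G₁' —[ μ ]→ Q') × S P' Q') →
         (grd G₂ —[ μ ]→ P' → ∃ λ Q' → (grd G₂' —[ μ ]→ Q') × S P' Q') →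
         grd (G₁ ⊕ G₂) —[ μ ]→ P' → ∃ λ Q' → (grd (G₁' ⊕ G₂') —[ μ ]→ Q') × S P' Q'
⊕-step step₁ step₂ (t-sumL t) = let Q' , u , r = step₁ t in Q' , t-sumL u , r
⊕-step step₁ step₂ (t-sumR t) = let Q' , u , r = step₂ t in Q' , t-sumR u , r

sα-⊕ : sα S (grd G₁) (grd G₁') → sα S (grd G₂) (grd G₂') → sα S (grd (G₁ ⊕ G₂)) (grd (G₁' ⊕ G₂'))
sα-⊕ {S = S} sim₁ sim₂ α v P' = ⊕-step {S = S} (sim₁ α v P') (sim₂ α v P')

sτ-⊕ : sτ S (grd G₁) (grd G₁') → sτ S (grd G₂) (grd G₂') → sτ S (grd (G₁ ⊕ G₂)) (grd (G₁' ⊕ G₂'))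
sτ-⊕ {S = S} sim₁ sim₂ P' = ⊕-step {S = S} (sim₁ P') (sim₂ P')

Summand-sα : sub R ⊆ S → Reflexive S → Summand R (grd G) (grd G') → sα S (grd G) (grd G')
Summand-sα _ _ (inj₁ (_ , _ , _ , refl , refl)) .tauA () _ t-tau
Summand-sα R⊆S _ (inj₂ (inj₁ (_ , _ , P , Q , r , refl , refl))) _ _ _ t-out =
  Q , t-out , R⊆S P Q (sub-extensive P Q r)
Summand-sα R⊆S _ (inj₂ (inj₂ (inj₁ (_ , P , Q , r , refl , refl)))) (inA _ c) _ _ t-inp =
  renP (inst c) Q , t-inp , R⊆S _ _ (inst c , P , Q , r , refl , refl)
Summand-sα _ S-refl (inj₂ (inj₂ (inj₂ refl))) _ _ P' t = P' , t , S-refl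

Summand-sτ : R ⊆ S → Reflexive S → Summand R (grd G) (grd G') → sτ S (grd G) (grd G')
Summand-sτ R⊆S _ (inj₁ (P , Q , r , refl , refl)) _ t-tau = Q , t-tau , R⊆S P Q r
Summand-sτ _ _ (inj₂ (inj₁ (_ , _ , _ , _ , _ , refl , refl))) _ ()
Summand-sτ _ _ (inj₂ (inj₂ (inj₁ (_ , _ , _ , _ , refl , refl)))) _ ()
Summand-sτ _ S-refl (inj₂ (inj₂ (inj₂ refl))) P' t = P' , t , S-refl

SumG-sα : sub R ⊆ S → Reflexive S → SumG R G G' → sα S (grd G) (grd G')
SumG-sα R⊆S S-refl (summand s) = Summand-sα R⊆S S-refl s
SumG-sα R⊆S S-refl (plus s t)  = sα-⊕ (SumG-sα R⊆S S-refl s) (SumG-sα R⊆S S-refl t)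

SumG-sτ : R ⊆ S → Reflexive S → SumG R G G' → sτ S (grd G) (grd G')
SumG-sτ R⊆S S-refl (summand s) = Summand-sτ R⊆S S-refl s
SumG-sτ R⊆S S-refl (plus s t)  = sτ-⊕ (SumG-sτ R⊆S S-refl s) (SumG-sτ R⊆S S-refl t)

SumG-bα : sub R ⊆ S → Reflexive S → SumG R G G' → bα S (grd G) (grd G')
SumG-bα R⊆S S-refl s = SumG-sα R⊆S S-refl s , SumG-sα (sub-inv R⊆S) S-refl (SumG-flip s)

SumG-bτ : R ⊆ S → Reflexive S → SumG R G G' → bτ S (grd G) (grd G')
SumG-bτ R⊆S S-refl s = SumG-sτ R⊆S S-refl s , SumG-sτ (inv-⊆ R⊆S) S-refl (SumG-flip s)

id∪sumg-compatible-b̄α : ∀ R → ((idF ∪F sumg) ∘F b̄α) R ⊆ (b̄α ∘F ((sub ∪F refl') ∘F (idF ∪F sumg))) R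
id∪sumg-compatible-b̄α R P Q (inj₁ b) = b̄α-mono (λ P Q → inj₁ ∘ sub-extensive P Q ∘ inj₁) P Q b
id∪sumg-compatible-b̄α R _ _ (inj₂ (G , G' , s̄ , refl , refl)) =
  inj₁ (sub-extensive _ _ (inj₂ (G , G' , s , refl , refl))) ,
  SumG-bα (λ _ _ (σ , P₀ , Q₀ , r , P≡ , Q≡) → inj₁ (σ , P₀ , Q₀ , inj₁ r , P≡ , Q≡)) (inj₂ refl) s
  where
    s : SumG R G G'
    s = SumG-mono (λ _ _ → proj₁) s̄

id∪sumg-compatible-b̄τ : ∀ R → ((idF ∪F sumg) ∘F (b̄α ∩F b̄τ)) R ⊆ (b̄τ ∘F ((idF ∪F refl') ∘F (idF ∪F sumg))) R
id∪sumg-compatible-b̄τ R P Q (inj₁ (_ , b)) = b̄τ-mono (λ _ _ → inj₁ ∘ inj₁) P Q b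
id∪sumg-compatible-b̄τ R _ _ (inj₂ (G , G' , s̄ , refl , refl)) =
  inj₁ (inj₂ (G , G' , s , refl , refl)) , SumG-bτ (λ _ _ → inj₁ ∘ inj₁) (inj₂ refl) s
  where
    s : SumG R G G'
    s = SumG-mono (λ _ _ → proj₁ ∘ proj₁) s̄

lemma35 : (∀ R → ((idF ∪F sumg) ∘F b̄α) R ⊆ (b̄α ∘F ((sub ∪F refl') ∘F (idF ∪F sumg))) R)
        × (∀ R → ((idF ∪F sumg) ∘F (b̄α ∩F b̄τ)) R ⊆ (b̄τ ∘F ((idF ∪F refl') ∘F (idF ∪F sumg))) R)
lemma35 = id∪sumg-compatible-b̄α , id∪sumg-compatible-b̄τ
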